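{- Let $X=\{1,\ldots,n\}$, let $\pi=(x_1,\ldots,x_n)$ be a circular ordering, and let $\delta$ be a dissimilarity map on $X$ satisfying the Kalmanson conditions with respect to $\pi$. Let $\mathcal{C}=\{C_1,\ldots,C_m\}$ be a partial circular ordering with a weighting $\mu$, such that whenever $x_a\in C_r$, $x_b\in C_s$ and $r<s$, we have $a<b$. Write $\delta_{ab}(c)$ for $\delta_{C_aC_b}(C_c)=\delta(C_a,C_c)+\delta(C_b,C_c)-\delta(C_a,C_b)$. Then for all block indices $1\le i<x<y<z<j<t\le m$, \[ \delta_{xy}(z)+\delta_{xz}(y)+\delta_{yz}(x)+\delta_{xy}(t)+\delta_{xz}(t)+\delta_{yz}(t)\ \ge\ 3\delta_{ij}(t)+\delta_{ij}(x)+\delta_{ij}(y)+\delta_{ij}(z). \]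
   Context: Dissimilarity map: a function $\delta:X\times X\to\mathbb{R}$ with $\delta(i,j)=\delta(j,i)\ge0$ and $\delta(i,i)=0$. Kalmanson conditions with respect to $\pi$: for all $1\le i<j<k<l\le n$, $\delta(x_i,x_j)+\delta(x_k,x_l)\le\delta(x_i,x_k)+\delta(x_j,x_l)$ and $\delta(x_i,x_l)+\delta(x_j,x_k)\le\delta(x_i,x_k)+\delta(x_j,x_l)$. Partial circular ordering: a partition $\{C_1,\ldots,C_m\}$ of $X$ into linearly ordered blocks (paths). $\hat C_r$ denotes the endpoints of $C_r$: the single element if $|C_r|=1$, and the two ends otherwise. Weighting: a function $\mu:X\to\mathbb{R}_{\ge0}$ with $\sum_{i\in C_r}\mu(i)=1$ and $\mu>0$ on $\hat C_r$. Block dissimilarity: $\delta(C_r,C_s)=\sum_{a\in C_r,b\in C_s}\mu(a)\mu(b)\delta(a,b)$. -}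

module Defs where

open import Level using (Level; _⊔_) renaming (suc to lsuc)
open import Data.Nat using (ℕ)
open import Data.Fin using (Fin) renaming (_<_ to _<ᶠ_)
open import Data.Fin.Permutation using (Permutation′; _⟨$⟩ʳ_)
open import Data.List using (List; []; _∷_; map; foldr; concat; allFin; head; last)
open import Data.List.Membership.Propositional using (_∈_)
open import Data.List.Relation.Binary.Permutation.Propositional using (_↭_)
open import Data.Maybe using (just)
open import Data.Product using (_×_)
open import Data.Sum using (_⊎_)
open import Relation.Nullary using (¬_)
open import Relation.Binary.Core using (Rel)
open import Relation.Binary.Structures using (IsTotalOrder)
open import Relation.Binary.PropositionalEquality using (_≡_; _≢_)
open import Algebra.Bundles using (CommutativeRing)

IsEndpoint : ∀ {n} → List (Fin n) → Fin n → Set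
IsEndpoint l a = head l ≡ just a ⊎ last l ≡ just a

-- partial circular ordering: blocks C_1..C_m (each a list = linear order)
-- forming a partition of X = Fin n into nonempty blocks
record IsPartialCircularOrdering {n m : ℕ} (C : Fin m → List (Fin n)) : Set where
  field
    nonempty  : ∀ r → C r ≢ []
    partition : concat (map C (allFin m)) ↭ allFin n

-- Real numbers are not available; we work over an arbitrary (totally)
-- ordered commutative ring, of which ℝ is an instance.
record OrderedCommutativeRing (c ℓ₁ ℓ₂ : Level) : Set (lsuc (c ⊔ ℓ₁ ⊔ ℓ₂)) where
  field
    commutativeRing : CommutativeRing c ℓ₁
  open CommutativeRing commutativeRing public
  infix 4 _≤_ _<_
  field
    _≤_          : Rel Carrier ℓ₂
    isTotalOrder : IsTotalOrder _≈_ _≤_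
    +-mono-≤     : ∀ {x y} z → x ≤ y → x + z ≤ y + z
    *-nonneg     : ∀ {x y} → 0# ≤ x → 0# ≤ y → 0# ≤ x * y

  _<_ : Rel Carrier (ℓ₁ ⊔ ℓ₂)
  x < y = x ≤ y × ¬ (x ≈ y)

module _ {c ℓ₁ ℓ₂} (R : OrderedCommutativeRing c ℓ₁ ℓ₂) where
  open OrderedCommutativeRing R

  ∑ : List Carrier → Carrier
  ∑ = foldr _+_ 0#

  record IsDissimilarity {n : ℕ} (δ : Fin n → Fin n → Carrier) : Set (c ⊔ ℓ₁ ⊔ ℓ₂) where
    field
      symmetric : ∀ i j → δ i j ≈ δ j i
      nonneg    : ∀ i j → 0# ≤ δ i j
      diag      : ∀ i → δ i i ≈ 0#

  Kalmanson : {n : ℕ} → (Fin n → Fin n → Carrier) → Permutation′ n → Set ℓ₂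
  Kalmanson {n} δ π = ∀ (i j k l : Fin n) → i <ᶠ j → j <ᶠ k → k <ᶠ l →
      (δ (x i) (x j) + δ (x k) (x l) ≤ δ (x i) (x k) + δ (x j) (x l))
    × (δ (x i) (x l) + δ (x j) (x k) ≤ δ (x i) (x k) + δ (x j) (x l))
    where
    x : Fin n → Fin n
    x i = π ⟨$⟩ʳ i

  blockDiss : {n : ℕ} → (Fin n → Fin n → Carrier) → (Fin n → Carrier) →
              List (Fin n) → List (Fin n) → Carrier
  blockDiss δ μ Cr Cs = ∑ (map (λ a → ∑ (map (λ b → μ a * μ b * δ a b) Cs)) Cr)

  blockδ : {n m : ℕ} → (Fin n → Fin n → Carrier) → (Fin n → Carrier) →
           (Fin m → List (Fin n)) → Fin m → Fin m → Fin m → Carrier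
  blockδ δ μ C a b c = blockDiss δ μ (C a) (C c) + blockDiss δ μ (C b) (C c) - blockDiss δ μ (C a) (C b)

  record IsWeighting {n m : ℕ} (C : Fin m → List (Fin n)) (μ : Fin n → Carrier) : Set (c ⊔ ℓ₁ ⊔ ℓ₂) where
    field
      nonneg    : ∀ i → 0# ≤ μ i
      sumOne    : ∀ r → ∑ (map μ (C r)) ≈ 1#
      endpoints : ∀ r a → IsEndpoint (C r) a → 0# < μ a

-- Averaging the Kalmanson inequalities of single points over four blocks, with weights summing
-- to one on each block, shows that the block dissimilarity is again Kalmanson with respect to
-- the order of the blocks. For a symmetric Kalmanson d, adding the two conditions for (i, u, j, t)
-- gives δ_ij(t) + δ_ij(u) ≤ 2 d(u, t); summing over u ∈ {x, y, z} yields the claim, because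
-- by symmetry the right-hand side is exactly 2 (d(x, t) + d(y, t) + d(z, t)).
module Submission where

open import Defs
open import Data.Nat using (ℕ)
open import Data.Fin using (Fin) renaming (_<_ to _<ᶠ_)
open import Data.Fin.Properties using (<-trans)
open import Data.Fin.Permutation using (Permutation′; _⟨$⟩ʳ_; _⟨$⟩ˡ_; inverseʳ)
open import Data.List using (List; []; _∷_; map)
open import Data.List.Membership.Propositional using (_∈_)
open import Data.List.Relation.Unary.Any using (here; there)
open import Data.Product using (_×_; _,_; proj₁; proj₂)
open import Relation.Binary.Bundles using (TotalOrder)
import Relation.Binary.PropositionalEquality as ≡
import Relation.Binary.Reasoning.PartialOrder as PartialOrderReasoning
import Relation.Binary.Reasoning.Setoid as SetoidReasoning
import Algebra.Properties.CommutativeSemigroup as CommutativeSemigroupProperties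
import Algebra.Solver.CommutativeMonoid as CommutativeMonoidSolver

BlocksInOrder : ∀ {n m} → Permutation′ n → (Fin m → List (Fin n)) → Set
BlocksInOrder {n} {m} π C =
  ∀ (r s : Fin m) (a b : Fin n) → (π ⟨$⟩ʳ a) ∈ C r → (π ⟨$⟩ʳ b) ∈ C s → r <ᶠ s → a <ᶠ b

module _ {c ℓ₁ ℓ₂} (R : OrderedCommutativeRing c ℓ₁ ℓ₂) where
  open OrderedCommutativeRing R

  totalOrder : TotalOrder c ℓ₁ ℓ₂
  totalOrder = record { isTotalOrder = isTotalOrder }

  open TotalOrder totalOrder using (poset) renaming (refl to ≤-refl)
  open CommutativeMonoidSolver +-commutativeMonoid using (solve; _⊜_; _⊕_)
  open CommutativeSemigroupProperties +-commutativeSemigroup using (interchange)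

  y≈0⇒x+y≈x : ∀ {x y} → y ≈ 0# → x + y ≈ x
  y≈0⇒x+y≈x {x} y≈0 = trans (+-congˡ y≈0) (+-identityʳ x)

  x≈0⇒y≈0⇒x+y≈0 : ∀ {x y} → x ≈ 0# → y ≈ 0# → x + y ≈ 0#
  x≈0⇒y≈0⇒x+y≈0 x≈0 y≈0 = trans (y≈0⇒x+y≈x y≈0) x≈0

  +-mono-≤₂ : ∀ {x y u v} → x ≤ y → u ≤ v → x + u ≤ y + v
  +-mono-≤₂ {x} {y} {u} {v} x≤y u≤v = begin
    x + u  ≤⟨ +-mono-≤ u x≤y ⟩
    y + u  ≈⟨ +-comm y u ⟩
    u + y  ≤⟨ +-mono-≤ y u≤v ⟩
    v + y  ≈⟨ +-comm v y ⟩
    y + v  ∎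
    where open PartialOrderReasoning poset

  x≤y⇒0≤y-x : ∀ {x y} → x ≤ y → 0# ≤ y - x
  x≤y⇒0≤y-x {x} {y} x≤y = begin
    0#     ≈⟨ -‿inverseʳ x ⟨
    x - x  ≤⟨ +-mono-≤ (- x) x≤y ⟩
    y - x  ∎
    where open PartialOrderReasoning poset

  *-monoʳ-≤-nonNeg : ∀ {k u v} → 0# ≤ k → u ≤ v → k * u ≤ k * v
  *-monoʳ-≤-nonNeg {k} {u} {v} 0≤k u≤v = begin
    k * u                ≈⟨ +-identityʳ (k * u) ⟨
    k * u + 0#           ≤⟨ +-mono-≤₂ ≤-refl (*-nonneg 0≤k (x≤y⇒0≤y-x u≤v)) ⟩
    k * u + k * (v - u)  ≈⟨ distribˡ k u (v - u) ⟨
    k * (u + (v - u))    ≈⟨ *-congˡ u+[v-u]≈v ⟩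
    k * v                ∎
    where
    open PartialOrderReasoning poset

    u+[v-u]≈v : u + (v - u) ≈ v
    u+[v-u]≈v = trans (solve 3 (λ u v -u → (u ⊕ (v ⊕ -u)) ⊜ (v ⊕ (u ⊕ -u))) refl u v (- u))
                      (y≈0⇒x+y≈x (-‿inverseʳ u))

  module _ {a} {A : Set a} where

    ∑-map-cong : ∀ (L : List A) {f g : A → Carrier} → (∀ x → f x ≈ g x) →
                 ∑ R (map f L) ≈ ∑ R (map g L)
    ∑-map-cong []      f≈g = refl
    ∑-map-cong (x ∷ L) f≈g = +-cong (f≈g x) (∑-map-cong L f≈g)

    ∑-map-0 : ∀ (L : List A) → ∑ R (map (λ _ → 0#) L) ≈ 0#
    ∑-map-0 []      = refl
    ∑-map-0 (x ∷ L) = trans (+-identityˡ _) (∑-map-0 L)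

    ∑-map-+ : ∀ (L : List A) (f g : A → Carrier) →
              ∑ R (map (λ x → f x + g x) L) ≈ ∑ R (map f L) + ∑ R (map g L)
    ∑-map-+ []      f g = sym (+-identityˡ 0#)
    ∑-map-+ (x ∷ L) f g = trans (+-congˡ (∑-map-+ L f g)) (interchange (f x) (g x) _ _)

    ∑-map-*ˡ : ∀ (L : List A) k (f : A → Carrier) → ∑ R (map (λ x → k * f x) L) ≈ k * ∑ R (map f L)
    ∑-map-*ˡ []      k f = sym (zeroʳ k)
    ∑-map-*ˡ (x ∷ L) k f = trans (+-congˡ (∑-map-*ˡ L k f)) (sym (distribˡ k (f x) _))

    ∑-map-mono : ∀ (L : List A) {f g : A → Carrier} → (∀ {x} → x ∈ L → f x ≤ g x) →
                 ∑ R (map f L) ≤ ∑ R (map g L)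
    ∑-map-mono []      f≤g = ≤-refl
    ∑-map-mono (x ∷ L) f≤g = +-mono-≤₂ (f≤g (here ≡.refl)) (∑-map-mono L (λ x∈L → f≤g (there x∈L)))

  ∑-map-swap : ∀ {a b} {A : Set a} {B : Set b} (L : List A) (M : List B) (f : A → B → Carrier) →
               ∑ R (map (λ x → ∑ R (map (f x) M)) L) ≈ ∑ R (map (λ y → ∑ R (map (λ x → f x y) L)) M)
  ∑-map-swap []      M f = sym (∑-map-0 M)
  ∑-map-swap (x ∷ L) M f =
    trans (+-congˡ (∑-map-swap L M f)) (sym (∑-map-+ M (f x) (λ y → ∑ R (map (λ x → f x y) L))))

  module WeightedSums {n : ℕ} (μ : Fin n → Carrier) where

    weightedSum : List (Fin n) → (Fin n → Carrier) → Carrier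
    weightedSum L f = ∑ R (map (λ a → μ a * f a) L)

    HasUnitWeight : List (Fin n) → Set ℓ₁
    HasUnitWeight L = ∑ R (map μ L) ≈ 1#

    weightedSum-cong : ∀ L {f g} → (∀ a → f a ≈ g a) → weightedSum L f ≈ weightedSum L g
    weightedSum-cong L f≈g = ∑-map-cong L (λ a → *-congˡ (f≈g a))

    weightedSum-+ : ∀ L f g → weightedSum L (λ a → f a + g a) ≈ weightedSum L f + weightedSum L g
    weightedSum-+ L f g = trans (∑-map-cong L (λ a → distribˡ (μ a) (f a) (g a))) (∑-map-+ L _ _)

    weightedSum-mono : (∀ a → 0# ≤ μ a) → ∀ L {f g} → (∀ {a} → a ∈ L → f a ≤ g a) →
                       weightedSum L f ≤ weightedSum L g
    weightedSum-mono μ≥0 L f≤g = ∑-map-mono L (λ a∈L → *-monoʳ-≤-nonNeg (μ≥0 _) (f≤g a∈L))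

    weightedSum-const : ∀ L → HasUnitWeight L → ∀ k → weightedSum L (λ _ → k) ≈ k
    weightedSum-const L ∑μ≈1 k = begin
      ∑ R (map (λ a → μ a * k) L)  ≈⟨ ∑-map-cong L (λ a → *-comm (μ a) k) ⟩
      ∑ R (map (λ a → k * μ a) L)  ≈⟨ ∑-map-*ˡ L k μ ⟩
      k * ∑ R (map μ L)            ≈⟨ *-congˡ ∑μ≈1 ⟩
      k * 1#                       ≈⟨ *-identityʳ k ⟩
      k                            ∎
      where open SetoidReasoning setoid

    blockDiss≈weightedSum : ∀ δ A B → blockDiss R δ μ A B ≈ weightedSum A (λ a → weightedSum B (δ a))
    blockDiss≈weightedSum δ A B = ∑-map-cong A (λ a →
      trans (∑-map-cong B (λ b → *-assoc (μ a) (μ b) (δ a b))) (∑-map-*ˡ B (μ a) (λ b → μ b * δ a b)))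

    blockDiss-sym : ∀ {δ} → (∀ a b → δ a b ≈ δ b a) → ∀ A B → blockDiss R δ μ A B ≈ blockDiss R δ μ B A
    blockDiss-sym {δ} δ-sym A B = trans (∑-map-swap A B (λ a b → μ a * μ b * δ a b))
      (∑-map-cong B (λ b → ∑-map-cong A (λ a → *-cong (*-comm (μ a) (μ b)) (δ-sym a b))))

  module _ {a} {X : Set a} where

    Kalmanson₄ : (X → X → Carrier) → X → X → X → X → Set ℓ₂
    Kalmanson₄ d p q r s = (d p q + d r s ≤ d p r + d q s) × (d p s + d q r ≤ d p r + d q s)

    triangleExcess : (X → X → Carrier) → X → X → X → Carrier
    triangleExcess d p q r = d p r + d q r - d p q

    module _ {d : X → X → Carrier} (d-sym : ∀ p q → d p q ≈ d q p) where

      kalmanson₄⇒excess≤ : ∀ {i u j t} → Kalmanson₄ d i u j t →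
        triangleExcess d i j t + triangleExcess d i j u ≤ d u t + d u t
      kalmanson₄⇒excess≤ {i} {u} {j} {t} (iu+jt≤ij+ut , it+uj≤ij+ut) = begin
        (d i t + d j t - d i j) + (d i u + d j u - d i j)
          ≈⟨ +-congˡ (+-congʳ (+-congˡ (d-sym j u))) ⟩
        (d i t + d j t - d i j) + (d i u + d u j - d i j)
          ≈⟨ solve 5 (λ it jt -ij iu uj →
               (((it ⊕ jt) ⊕ -ij) ⊕ ((iu ⊕ uj) ⊕ -ij)) ⊜ (((iu ⊕ jt) ⊕ (it ⊕ uj)) ⊕ (-ij ⊕ -ij)))
               refl (d i t) (d j t) (- d i j) (d i u) (d u j) ⟩
        ((d i u + d j t) + (d i t + d u j)) + (- d i j + - d i j)
          ≤⟨ +-mono-≤ _ (+-mono-≤₂ iu+jt≤ij+ut it+uj≤ij+ut) ⟩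
        ((d i j + d u t) + (d i j + d u t)) + (- d i j + - d i j)
          ≈⟨ solve 3 (λ ij -ij ut →
               (((ij ⊕ ut) ⊕ (ij ⊕ ut)) ⊕ (-ij ⊕ -ij)) ⊜ (((ut ⊕ ut) ⊕ (ij ⊕ -ij)) ⊕ (ij ⊕ -ij)))
               refl (d i j) (- d i j) (d u t) ⟩
        ((d u t + d u t) + (d i j - d i j)) + (d i j - d i j)
          ≈⟨ trans (y≈0⇒x+y≈x (-‿inverseʳ (d i j))) (y≈0⇒x+y≈x (-‿inverseʳ (d i j))) ⟩
        d u t + d u t  ∎
        where open PartialOrderReasoning poset

      -- Negated distances are atoms for the solver; what is left over cancels by symmetry.
      excesses-sum : ∀ x y z t →
        triangleExcess d x y z + triangleExcess d x z y + triangleExcess d y z x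
          + triangleExcess d x y t + triangleExcess d x z t + triangleExcess d y z t
        ≈ (d x t + d x t) + ((d y t + d y t) + (d z t + d z t))
      excesses-sum x y z t = begin
        (d x z + d y z - d x y) + (d x y + d z y - d x z) + (d y x + d z x - d y z)
          + (d x t + d y t - d x y) + (d x t + d z t - d x z) + (d y t + d z t - d y z)
          ≈⟨ solve 12 (λ xy yx xz zx yz zy -xy -xz -yz xt yt zt →
               ((((((xz ⊕ yz) ⊕ -xy) ⊕ ((xy ⊕ zy) ⊕ -xz)) ⊕ ((yx ⊕ zx) ⊕ -yz))
                 ⊕ ((xt ⊕ yt) ⊕ -xy)) ⊕ ((xt ⊕ zt) ⊕ -xz)) ⊕ ((yt ⊕ zt) ⊕ -yz)
               ⊜ ((xt ⊕ xt) ⊕ ((yt ⊕ yt) ⊕ (zt ⊕ zt)))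
                 ⊕ (((xy ⊕ -xy) ⊕ (yx ⊕ -xy)) ⊕ (((xz ⊕ -xz) ⊕ (zx ⊕ -xz)) ⊕ ((yz ⊕ -yz) ⊕ (zy ⊕ -yz)))))
               refl (d x y) (d y x) (d x z) (d z x) (d y z) (d z y) (- d x y) (- d x z) (- d y z)
                    (d x t) (d y t) (d z t) ⟩
        ((d x t + d x t) + ((d y t + d y t) + (d z t + d z t)))
          + (symmetryDefect x y + (symmetryDefect x z + symmetryDefect y z))
          ≈⟨ y≈0⇒x+y≈x (x≈0⇒y≈0⇒x+y≈0 (symmetryDefect≈0 x y) (x≈0⇒y≈0⇒x+y≈0 (symmetryDefect≈0 x z) (symmetryDefect≈0 y z))) ⟩
        (d x t + d x t) + ((d y t + d y t) + (d z t + d z t))  ∎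
        where
        open SetoidReasoning setoid
        symmetryDefect : X → X → Carrier
        symmetryDefect p q = (d p q - d p q) + (d q p - d p q)

        symmetryDefect≈0 : ∀ p q → symmetryDefect p q ≈ 0#
        symmetryDefect≈0 p q = x≈0⇒y≈0⇒x+y≈0 (-‿inverseʳ (d p q)) (trans (+-congʳ (d-sym q p)) (-‿inverseʳ (d p q)))

      sixPointInequality : ∀ {i x y z j t} →
        Kalmanson₄ d i x j t → Kalmanson₄ d i y j t → Kalmanson₄ d i z j t →
        triangleExcess d i j t + triangleExcess d i j t + triangleExcess d i j t
          + triangleExcess d i j x + triangleExcess d i j y + triangleExcess d i j z
        ≤ triangleExcess d x y z + triangleExcess d x z y + triangleExcess d y z x
          + triangleExcess d x y t + triangleExcess d x z t + triangleExcess d y z t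
      sixPointInequality {i} {x} {y} {z} {j} {t} kx ky kz = begin
        Eₜ + Eₜ + Eₜ + E x + E y + E z
          ≈⟨ solve 4 (λ eₜ ex ey ez → (((((eₜ ⊕ eₜ) ⊕ eₜ) ⊕ ex) ⊕ ey) ⊕ ez)
                                       ⊜ ((eₜ ⊕ ex) ⊕ ((eₜ ⊕ ey) ⊕ (eₜ ⊕ ez))))
                     refl Eₜ (E x) (E y) (E z) ⟩
        (Eₜ + E x) + ((Eₜ + E y) + (Eₜ + E z))
          ≤⟨ +-mono-≤₂ (kalmanson₄⇒excess≤ kx) (+-mono-≤₂ (kalmanson₄⇒excess≤ ky) (kalmanson₄⇒excess≤ kz)) ⟩
        (d x t + d x t) + ((d y t + d y t) + (d z t + d z t))
          ≈⟨ excesses-sum x y z t ⟨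
        triangleExcess d x y z + triangleExcess d x z y + triangleExcess d y z x
          + triangleExcess d x y t + triangleExcess d x z t + triangleExcess d y z t  ∎
        where
        open PartialOrderReasoning poset
        E : X → Carrier
        E = triangleExcess d i j
        Eₜ : Carrier
        Eₜ = E t

  module BlockAveraging {n : ℕ} (δ : Fin n → Fin n → Carrier) (μ : Fin n → Carrier) (μ≥0 : ∀ a → 0# ≤ μ a) where
    open WeightedSums μ

    module Average₄ (A B C E : List (Fin n)) where

      ⟨_⟩ : (Fin n → Fin n → Fin n → Fin n → Carrier) → Carrier
      ⟨ F ⟩ = weightedSum A (λ p → weightedSum B (λ q → weightedSum C (λ r → weightedSum E (λ s → F p q r s))))

      ⟨⟩-+ : ∀ F G → ⟨ (λ p q r s → F p q r s + G p q r s) ⟩ ≈ ⟨ F ⟩ + ⟨ G ⟩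
      ⟨⟩-+ F G =
        trans (weightedSum-cong A (λ p →
          trans (weightedSum-cong B (λ q →
            trans (weightedSum-cong C (λ r → weightedSum-+ E _ _)) (weightedSum-+ C _ _)))
          (weightedSum-+ B _ _)))
        (weightedSum-+ A _ _)

      ⟨⟩-mono : ∀ {F G} → (∀ {p q r s} → p ∈ A → q ∈ B → r ∈ C → s ∈ E → F p q r s ≤ G p q r s) →
                ⟨ F ⟩ ≤ ⟨ G ⟩
      ⟨⟩-mono F≤G =
        weightedSum-mono μ≥0 A (λ p∈A → weightedSum-mono μ≥0 B (λ q∈B →
          weightedSum-mono μ≥0 C (λ r∈C → weightedSum-mono μ≥0 E (λ s∈E → F≤G p∈A q∈B r∈C s∈E))))

      ⟨⟩-+-mono : ∀ {F₁ F₂ G₁ G₂ f₁ f₂ g₁ g₂} → ⟨ F₁ ⟩ ≈ f₁ → ⟨ F₂ ⟩ ≈ f₂ → ⟨ G₁ ⟩ ≈ g₁ → ⟨ G₂ ⟩ ≈ g₂ →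
        (∀ {p q r s} → p ∈ A → q ∈ B → r ∈ C → s ∈ E →
           F₁ p q r s + F₂ p q r s ≤ G₁ p q r s + G₂ p q r s) →
        f₁ + f₂ ≤ g₁ + g₂
      ⟨⟩-+-mono {F₁} {F₂} {G₁} {G₂} {f₁} {f₂} {g₁} {g₂} ⟨F₁⟩≈f₁ ⟨F₂⟩≈f₂ ⟨G₁⟩≈g₁ ⟨G₂⟩≈g₂ F≤G = begin
        f₁ + f₂                                    ≈⟨ trans (⟨⟩-+ F₁ F₂) (+-cong ⟨F₁⟩≈f₁ ⟨F₂⟩≈f₂) ⟨
        ⟨ (λ p q r s → F₁ p q r s + F₂ p q r s) ⟩  ≤⟨ ⟨⟩-mono F≤G ⟩
        ⟨ (λ p q r s → G₁ p q r s + G₂ p q r s) ⟩  ≈⟨ trans (⟨⟩-+ G₁ G₂) (+-cong ⟨G₁⟩≈g₁ ⟨G₂⟩≈g₂) ⟩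
        g₁ + g₂                                    ∎
        where open PartialOrderReasoning poset

      module Marginals (∑A : HasUnitWeight A) (∑B : HasUnitWeight B)
               (∑C : HasUnitWeight C) (∑E : HasUnitWeight E) where

        ⟨δ₁₂⟩ : ⟨ (λ p q _ _ → δ p q) ⟩ ≈ blockDiss R δ μ A B
        ⟨δ₁₂⟩ = trans (weightedSum-cong A (λ p → weightedSum-cong B (λ q →
                  trans (weightedSum-cong C (λ r → weightedSum-const E ∑E _)) (weightedSum-const C ∑C _))))
                (sym (blockDiss≈weightedSum δ A B))

        ⟨δ₁₃⟩ : ⟨ (λ p _ r _ → δ p r) ⟩ ≈ blockDiss R δ μ A C
        ⟨δ₁₃⟩ = trans (weightedSum-cong A (λ p →
                  trans (weightedSum-cong B (λ q → weightedSum-cong C (λ r → weightedSum-const E ∑E _)))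
                        (weightedSum-const B ∑B _)))
                (sym (blockDiss≈weightedSum δ A C))

        ⟨δ₁₄⟩ : ⟨ (λ p _ _ s → δ p s) ⟩ ≈ blockDiss R δ μ A E
        ⟨δ₁₄⟩ = trans (weightedSum-cong A (λ p →
                  trans (weightedSum-cong B (λ q → weightedSum-const C ∑C _)) (weightedSum-const B ∑B _)))
                (sym (blockDiss≈weightedSum δ A E))

        ⟨δ₂₃⟩ : ⟨ (λ _ q r _ → δ q r) ⟩ ≈ blockDiss R δ μ B C
        ⟨δ₂₃⟩ = trans (weightedSum-const A ∑A _)
                (trans (weightedSum-cong B (λ q → weightedSum-cong C (λ r → weightedSum-const E ∑E _)))
                       (sym (blockDiss≈weightedSum δ B C)))

        ⟨δ₂₄⟩ : ⟨ (λ _ q _ s → δ q s) ⟩ ≈ blockDiss R δ μ B E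
        ⟨δ₂₄⟩ = trans (weightedSum-const A ∑A _)
                (trans (weightedSum-cong B (λ q → weightedSum-const C ∑C _))
                       (sym (blockDiss≈weightedSum δ B E)))

        ⟨δ₃₄⟩ : ⟨ (λ _ _ r s → δ r s) ⟩ ≈ blockDiss R δ μ C E
        ⟨δ₃₄⟩ = trans (weightedSum-cong A (λ p → weightedSum-const B ∑B _))
                (trans (weightedSum-const A ∑A _) (sym (blockDiss≈weightedSum δ C E)))

    kalmanson₄-blockDiss : ∀ A B C E →
      HasUnitWeight A → HasUnitWeight B → HasUnitWeight C → HasUnitWeight E →
      (∀ {p q r s} → p ∈ A → q ∈ B → r ∈ C → s ∈ E → Kalmanson₄ δ p q r s) →
      Kalmanson₄ (blockDiss R δ μ) A B C E
    kalmanson₄-blockDiss A B C E ∑A ∑B ∑C ∑E kalmanson₄-pointwise =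
        ⟨⟩-+-mono ⟨δ₁₂⟩ ⟨δ₃₄⟩ ⟨δ₁₃⟩ ⟨δ₂₄⟩ (λ p∈A q∈B r∈C s∈E → proj₁ (kalmanson₄-pointwise p∈A q∈B r∈C s∈E))
      , ⟨⟩-+-mono ⟨δ₁₄⟩ ⟨δ₂₃⟩ ⟨δ₁₃⟩ ⟨δ₂₄⟩ (λ p∈A q∈B r∈C s∈E → proj₂ (kalmanson₄-pointwise p∈A q∈B r∈C s∈E))
      where
      open Average₄ A B C E
      open Marginals ∑A ∑B ∑C ∑E

  module KalmansonBlocks {n m : ℕ} (π : Permutation′ n) (δ : Fin n → Fin n → Carrier) (kalmanson : Kalmanson R δ π)
                         (C : Fin m → List (Fin n)) (inOrder : BlocksInOrder π C) where

    kalmanson₄-points : ∀ {a b e f} → a <ᶠ b → b <ᶠ e → e <ᶠ f →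
      ∀ {p q r s} → p ∈ C a → q ∈ C b → r ∈ C e → s ∈ C f → Kalmanson₄ δ p q r s
    kalmanson₄-points a<b b<e e<f {p} {q} {r} {s} p∈a q∈b r∈e s∈f
      with π ⟨$⟩ˡ p | inverseʳ π {p} | π ⟨$⟩ˡ q | inverseʳ π {q}
         | π ⟨$⟩ˡ r | inverseʳ π {r} | π ⟨$⟩ˡ s | inverseʳ π {s}
    ... | i | ≡.refl | j | ≡.refl | k | ≡.refl | l | ≡.refl =
      kalmanson i j k l (inOrder _ _ i j p∈a q∈b a<b) (inOrder _ _ j k q∈b r∈e b<e)
                        (inOrder _ _ k l r∈e s∈f e<f)

    kalmanson₄-blocks : ∀ {μ} → IsWeighting R C μ → ∀ {a b e f} → a <ᶠ b → b <ᶠ e → e <ᶠ f →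
      Kalmanson₄ (λ r s → blockDiss R δ μ (C r) (C s)) a b e f
    kalmanson₄-blocks {μ} w {a} {b} {e} {f} a<b b<e e<f =
      kalmanson₄-blockDiss (C a) (C b) (C e) (C f) (sumOne a) (sumOne b) (sumOne e) (sumOne f)
        (kalmanson₄-points a<b b<e e<f)
      where
      open IsWeighting w using (nonneg; sumOne)
      open BlockAveraging δ μ nonneg using (kalmanson₄-blockDiss)

mainTheorem10 : ∀ {c ℓ₁ ℓ₂} (R : OrderedCommutativeRing c ℓ₁ ℓ₂) →
    let open OrderedCommutativeRing R in
    (n : ℕ) (π : Permutation′ n) (δ : Fin n → Fin n → Carrier) →
    IsDissimilarity R δ → Kalmanson R δ π →
    (m : ℕ) (C : Fin m → List (Fin n)) (μ : Fin n → Carrier) →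
    IsPartialCircularOrdering C → IsWeighting R C μ →
    (∀ (r s : Fin m) (a b : Fin n) → (π ⟨$⟩ʳ a) ∈ C r → (π ⟨$⟩ʳ b) ∈ C s → r <ᶠ s → a <ᶠ b) →
    ∀ (i x y z j t : Fin m) → i <ᶠ x → x <ᶠ y → y <ᶠ z → z <ᶠ j → j <ᶠ t →
    blockδ R δ μ C i j t + blockδ R δ μ C i j t + blockδ R δ μ C i j t
    + blockδ R δ μ C i j x + blockδ R δ μ C i j y + blockδ R δ μ C i j z
    ≤ blockδ R δ μ C x y z + blockδ R δ μ C x z y + blockδ R δ μ C y z x
    + blockδ R δ μ C x y t + blockδ R δ μ C x z t + blockδ R δ μ C y z t
mainTheorem10 R n π δ dissimilarity kalmanson m C μ _ weighting inOrder i x y z j t i<x x<y y<z z<j j<t =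
  sixPointInequality R (λ r s → blockDiss-sym (IsDissimilarity.symmetric dissimilarity) (C r) (C s))
    (kalmanson₄-blocks weighting i<x x<j j<t)
    (kalmanson₄-blocks weighting i<y y<j j<t)
    (kalmanson₄-blocks weighting i<z z<j j<t)
  where
  open WeightedSums R μ using (blockDiss-sym)
  open KalmansonBlocks R π δ kalmanson C inOrder using (kalmanson₄-blocks)
  y<j : y <ᶠ j
  y<j = <-trans y<z z<j
  x<j : x <ᶠ j
  x<j = <-trans x<y y<j
  i<y : i <ᶠ y
  i<y = <-trans i<x x<y
  i<z : i <ᶠ z
  i<z = <-trans i<y y<z
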